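{- Let $\Phi(x_1,\dots,x_d)$ be a system of divisibility constraints with the elimination property for the order $x_1\prec\dots\prec x_d$. For every primitive polynomial $f$ and every $j\in[1,d]$, the set $F:=\{g: f\mid g\text{ appears in }\Phi\}$ has at most one element with leading variable $x_j$.
   Context: Linear polynomials have integer coefficients and constant; primitive means non-zero with gcd of coefficients and constant equal to $1$; the primitive part of non-zero $g$ is the primitive $f$ with $g=\gcd(g)f$; $\mathbb{Z}[x_1,\dots,x_k]$ denotes linear polynomials in $x_1,\dots,x_k$. Divisibility $m\mid n$ of integers holds iff $n=qm$ for a unique $q$; a system of divisibility constraints is $\bigwedge_i f_i\mid g_i$ with linear $f_i\ne0$, $g_i$. $\mathrm{lv}(g)$ (leading variable) is the $\prec$-largest variable with non-zero coefficient in $g$, $\bot$ if $g$ is constant, with $\bot\prec x_i$ for all $i$ and $x_0:=\bot$. The divisibility module $M_f(\Phi)$ of primitive $f$ is the smallest set of linear polynomials containing $f$, closed under integer linear combinations, such that if $g\mid h$ is in $\Phi$ and $bg\in M_f(\Phi)$ ($b\in\mathbb{Z}$) then $bh\in M_f(\Phi)$. $\Phi$ has the elimination property for $\prec$ if for every primitive part $f$ of a polynomial appearing in a left-hand side of $\Phi$ and every $0\le k\le d$, the set $\{g:\mathrm{lv}(g)\preceq x_k\text{ and } f\mid g\text{ appears in }\Phi\}$ is a set of linearly independent polynomials forming a basis of $M_f(\Phi)\cap\mathbb{Z}[x_1,\dots,x_k]$. -}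

module Defs where

open import Data.Nat as ℕ using (ℕ; zero; suc)
open import Data.Integer as ℤ using (ℤ; 0ℤ; 1ℤ)
open import Data.Integer.GCD using (gcd)
open import Data.Vec as Vec using (Vec; []; _∷_)
open import Data.Fin using (Fin; zero; suc)
open import Data.List using (List)
open import Data.List.Membership.Propositional using (_∈_)
open import Data.Product using (Σ; ∃; _×_; _,_)
open import Relation.Binary.PropositionalEquality using (_≡_; _≢_)
open import Relation.Nullary using (yes; no)
open import Function.Definitions using (Injective)
open import Function.Bundles using (_⇔_)

-- A linear polynomial c₁x₁ + … + c_d x_d + c₀ in d variables.
-- coeffs is the vector (c₁, …, c_d) (position i, 0-based, is x_{i+1}).
record Lin (d : ℕ) : Set where
  constructor lin
  field
    coeffs : Vec ℤ d
    const  : ℤ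
open Lin public

0L : ∀ {d} → Lin d
0L = lin (Vec.replicate _ 0ℤ) 0ℤ

_+L_ : ∀ {d} → Lin d → Lin d → Lin d
lin a c +L lin b e = lin (Vec.zipWith ℤ._+_ a b) (c ℤ.+ e)

_·L_ : ∀ {d} → ℤ → Lin d → Lin d
k ·L lin a c = lin (Vec.map (k ℤ.*_) a) (k ℤ.* c)

linComb : ∀ {d} (n : ℕ) → (Fin n → ℤ) → (Fin n → Lin d) → Lin d
linComb zero    c g = 0L
linComb (suc n) c g = (c zero ·L g zero) +L linComb n (λ i → c (suc i)) (λ i → g (suc i))

content : ∀ {d} → Lin d → ℤ
content (lin a c) = Vec.foldr _ gcd c a

Primitive : ∀ {d} → Lin d → Set
Primitive f = f ≢ 0L × content f ≡ 1ℤ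

PrimitivePartOf : ∀ {d} → Lin d → Lin d → Set
PrimitivePartOf f g = g ≢ 0L × Primitive f × g ≡ (content g ·L f)

-- leading variable index: 0 stands for ⊥ (constant polynomial),
-- i ∈ [1,d] stands for x_i, with x₁ ≺ … ≺ x_d.
lvVec : ∀ {d} → Vec ℤ d → ℕ
lvVec [] = 0
lvVec (c ∷ cs) with lvVec cs
... | suc m = suc (suc m)
... | zero with c ℤ.≟ 0ℤ
...   | yes _ = 0
...   | no  _ = 1

lv : ∀ {d} → Lin d → ℕ
lv g = lvVec (coeffs g)

-- A system of divisibility constraints ⋀ fᵢ ∣ gᵢ, as a list of pairs (fᵢ , gᵢ).
System : ℕ → Set
System d = List (Lin d × Lin d)

WellFormed : ∀ {d} → System d → Set
WellFormed Φ = ∀ f g → (f , g) ∈ Φ → f ≢ 0L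

data DivModule {d} (Φ : System d) (f : Lin d) : Lin d → Set where
  gen   : DivModule Φ f f
  zro   : DivModule Φ f 0L
  add   : ∀ {g h} → DivModule Φ f g → DivModule Φ f h → DivModule Φ f (g +L h)
  scale : ∀ (c : ℤ) {g} → DivModule Φ f g → DivModule Φ f (c ·L g)
  prop  : ∀ {g h} → (g , h) ∈ Φ → (b : ℤ) →
          DivModule Φ f (b ·L g) → DivModule Φ f (b ·L h)

LinIndep : ∀ {d} → (Lin d → Set) → Set
LinIndep {d} S = ∀ (n : ℕ) (g : Fin n → Lin d) → Injective _≡_ _≡_ g →
  (∀ i → S (g i)) → (c : Fin n → ℤ) → linComb n c g ≡ 0L → ∀ i → c i ≡ 0ℤ

Span : ∀ {d} → (Lin d → Set) → Lin d → Set
Span {d} S h = Σ ℕ λ n → Σ (Fin n → Lin d) λ g → Σ (Fin n → ℤ) λ c →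
  (∀ i → S (g i)) × h ≡ linComb n c g

IsBasisOf : ∀ {d} → (Lin d → Set) → (Lin d → Set) → Set
IsBasisOf {d} S T = LinIndep S × (∀ h → S h → T h) × (∀ h → T h ⇔ Span S h)

ElimProperty : ∀ {d} → System d → Set
ElimProperty {d} Φ = ∀ (f : Lin d) →
  (∃ λ g → ∃ λ h → (g , h) ∈ Φ × PrimitivePartOf f g) →
  ∀ (k : ℕ) → k ℕ.≤ d →
  IsBasisOf (λ g → lv g ℕ.≤ k × (f , g) ∈ Φ)
            (λ g → DivModule Φ f g × lv g ℕ.≤ k)

{-# OPTIONS --safe #-}
-- Suppose g ≢ g′ both have leading variable x_j, with leading coefficients a and a′.
-- Then h = a g′ − a′ g lies in M_f(Φ) and has leading variable ≺ x_j, so by the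
-- elimination property at level j − 1 it is a combination of right-hand sides f ∣ u
-- of Φ with lv u ≺ x_j. Hence a′ g − a g′ + h = 0 is a linear relation among distinct
-- right-hand sides with lv ⪯ x_j, and independence at level j forces a′ = 0,
-- contradicting that x_j is the leading variable of g′.
module Submission where

open import Defs
open import Data.Nat using (ℕ; _≤_; _<_; zero; suc; pred; z≤n; s≤s)
import Data.Nat.Properties as ℕ
open import Data.Integer as ℤ using (ℤ; 0ℤ; 1ℤ; -_)
open import Data.Integer.Tactic.RingSolver using (solve-∀)
import Data.Integer.Properties as ℤ
open import Data.Fin using (Fin; zero; suc; toℕ; fromℕ<)
import Data.Fin.Properties as Fin
open import Data.Vec as Vec using (Vec; []; _∷_; lookup)
import Data.Vec.Properties as Vec
open import Data.Vec.Functional as Vector using (updateAt)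
open import Data.Product using (_×_; _,_; proj₁; proj₂)
open import Data.List.Membership.Propositional using (_∈_)
open import Function using (_∘_)
open import Function.Bundles using (Equivalence)
open import Function.Definitions using (Injective)
open import Relation.Nullary using (Dec; yes; no; contradiction)
open import Relation.Binary.PropositionalEquality
  using (_≡_; _≢_; refl; sym; trans; cong; cong₂; subst; module ≡-Reasoning)

module _ {d : ℕ} where

  -- toVec turns +L into Vec.zipWith ℤ._+_ and ·L into Vec.map definitionally,
  -- so the ℤ-module laws of Lin d below are inherited from laws about vectors.
  toVec : Lin d → Vec ℤ (suc d)
  toVec u = const u ∷ coeffs u

  toVec-injective : ∀ {u v : Lin d} → toVec u ≡ toVec v → u ≡ v
  toVec-injective eq with Vec.∷-injective eq
  ... | c≡e , a≡b = cong₂ lin a≡b c≡e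

  _≟L_ : (u v : Lin d) → Dec (u ≡ v)
  lin a c ≟L lin b e with Vec.≡-dec ℤ._≟_ a b | c ℤ.≟ e
  ... | yes refl | yes refl = yes refl
  ... | no a≢b   | _        = no (a≢b ∘ cong coeffs)
  ... | yes _    | no c≢e   = no (c≢e ∘ cong const)

  lookup-coeffs-combination : ∀ x y (u v : Lin d) i →
    lookup (coeffs ((x ·L u) +L (y ·L v))) i ≡ x ℤ.* lookup (coeffs u) i ℤ.+ y ℤ.* lookup (coeffs v) i
  lookup-coeffs-combination x y u v i = begin
    lookup (Vec.zipWith ℤ._+_ (Vec.map (x ℤ.*_) (coeffs u)) (Vec.map (y ℤ.*_) (coeffs v))) i
      ≡⟨ Vec.lookup-zipWith ℤ._+_ i (Vec.map (x ℤ.*_) (coeffs u)) (Vec.map (y ℤ.*_) (coeffs v)) ⟩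
    lookup (Vec.map (x ℤ.*_) (coeffs u)) i ℤ.+ lookup (Vec.map (y ℤ.*_) (coeffs v)) i
      ≡⟨ cong₂ ℤ._+_ (Vec.lookup-map i (x ℤ.*_) (coeffs u)) (Vec.lookup-map i (y ℤ.*_) (coeffs v)) ⟩
    x ℤ.* lookup (coeffs u) i ℤ.+ y ℤ.* lookup (coeffs v) i ∎
    where open ≡-Reasoning

  private
    map-distribʳ : ∀ {n} x y (a : Vec ℤ n) →
      Vec.map ((x ℤ.+ y) ℤ.*_) a ≡ Vec.zipWith ℤ._+_ (Vec.map (x ℤ.*_) a) (Vec.map (y ℤ.*_) a)
    map-distribʳ x y []       = refl
    map-distribʳ x y (a ∷ as) = cong₂ _∷_ (ℤ.*-distribʳ-+ a x y) (map-distribʳ x y as)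

  +L-assoc : ∀ (u v w : Lin d) → ((u +L v) +L w) ≡ (u +L (v +L w))
  +L-assoc u v w = toVec-injective (Vec.zipWith-assoc ℤ.+-assoc (toVec u) (toVec v) (toVec w))

  +L-comm : ∀ (u v : Lin d) → (u +L v) ≡ (v +L u)
  +L-comm u v = toVec-injective (Vec.zipWith-comm ℤ.+-comm (toVec u) (toVec v))

  +L-identityˡ : ∀ (u : Lin d) → (0L +L u) ≡ u
  +L-identityˡ u = toVec-injective (Vec.zipWith-identityˡ ℤ.+-identityˡ (toVec u))

  ·L-identityˡ : ∀ (u : Lin d) → (1ℤ ·L u) ≡ u
  ·L-identityˡ u = toVec-injective (trans (Vec.map-cong ℤ.*-identityˡ (toVec u)) (Vec.map-id (toVec u)))

  ·L-zeroˡ : ∀ (u : Lin d) → (0ℤ ·L u) ≡ 0L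
  ·L-zeroˡ u = toVec-injective (trans (Vec.map-cong ℤ.*-zeroˡ (toVec u)) (Vec.map-const (toVec u) 0ℤ))

  ·L-distribʳ : ∀ x y (u : Lin d) → ((x ℤ.+ y) ·L u) ≡ ((x ·L u) +L (y ·L u))
  ·L-distribʳ x y u = toVec-injective (map-distribʳ x y (toVec u))

  ·L-inverseʳ : ∀ x (u : Lin d) → ((x ·L u) +L ((- x) ·L u)) ≡ 0L
  ·L-inverseʳ x u = begin
    (x ·L u) +L ((- x) ·L u) ≡⟨ ·L-distribʳ x (- x) u ⟨
    (x ℤ.+ - x) ·L u         ≡⟨ cong (_·L u) (ℤ.+-inverseʳ x) ⟩
    0ℤ ·L u                  ≡⟨ ·L-zeroˡ u ⟩
    0L                       ∎
    where open ≡-Reasoning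

  ·L-cancelPairs : ∀ x y (u v : Lin d) →
    ((x ·L u) +L (((- y) ·L v) +L ((y ·L v) +L ((- x) ·L u)))) ≡ 0L
  ·L-cancelPairs x y u v = begin
    (x ·L u) +L (((- y) ·L v) +L ((y ·L v) +L ((- x) ·L u)))
      ≡⟨ cong ((x ·L u) +L_) (+L-assoc ((- y) ·L v) (y ·L v) ((- x) ·L u)) ⟨
    (x ·L u) +L ((((- y) ·L v) +L (y ·L v)) +L ((- x) ·L u))
      ≡⟨ cong (λ w → (x ·L u) +L (w +L ((- x) ·L u))) (+L-comm ((- y) ·L v) (y ·L v)) ⟩
    (x ·L u) +L (((y ·L v) +L ((- y) ·L v)) +L ((- x) ·L u))
      ≡⟨ cong (λ w → (x ·L u) +L (w +L ((- x) ·L u))) (·L-inverseʳ y v) ⟩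
    (x ·L u) +L (0L +L ((- x) ·L u))
      ≡⟨ cong ((x ·L u) +L_) (+L-identityˡ ((- x) ·L u)) ⟩
    (x ·L u) +L ((- x) ·L u)
      ≡⟨ ·L-inverseʳ x u ⟩
    0L ∎
    where open ≡-Reasoning

  +L-swap : ∀ (u v w : Lin d) → (u +L (v +L w)) ≡ (v +L (u +L w))
  +L-swap u v w = begin
    u +L (v +L w) ≡⟨ +L-assoc u v w ⟨
    (u +L v) +L w ≡⟨ cong (_+L w) (+L-comm u v) ⟩
    (v +L u) +L w ≡⟨ +L-assoc v u w ⟩
    v +L (u +L w) ∎
    where open ≡-Reasoning

injective-∷ : ∀ {A : Set} {n} {x : A} {f : Fin n → A} →
  (∀ i → f i ≢ x) → Injective _≡_ _≡_ f → Injective _≡_ _≡_ (x Vector.∷ f)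
injective-∷ f≢x f-inj {zero}  {zero}  _  = refl
injective-∷ f≢x f-inj {zero}  {suc j} eq = contradiction (sym eq) (f≢x j)
injective-∷ f≢x f-inj {suc i} {zero}  eq = contradiction eq (f≢x i)
injective-∷ f≢x f-inj {suc i} {suc j} eq = cong suc (f-inj eq)

module _ {d : ℕ} where

  linComb-updateAt : ∀ n (c : Fin n → ℤ) (k : Fin n → Lin d) i x →
    linComb n (updateAt c i (ℤ._+_ x)) k ≡ ((x ·L k i) +L linComb n c k)
  linComb-updateAt (suc n) c k zero x = begin
    ((x ℤ.+ c zero) ·L k zero) +L rest              ≡⟨ cong (_+L rest) (·L-distribʳ x (c zero) (k zero)) ⟩
    ((x ·L k zero) +L (c zero ·L k zero)) +L rest   ≡⟨ +L-assoc (x ·L k zero) (c zero ·L k zero) rest ⟩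
    (x ·L k zero) +L ((c zero ·L k zero) +L rest)   ∎
    where
    open ≡-Reasoning
    rest : Lin d
    rest = linComb n (Vector.tail c) (Vector.tail k)
  linComb-updateAt (suc n) c k (suc i) x =
    trans (cong ((c zero ·L k zero) +L_) (linComb-updateAt n (Vector.tail c) (Vector.tail k) i x))
          (+L-swap (c zero ·L k zero) (x ·L k (suc i)) (linComb n (Vector.tail c) (Vector.tail k)))

  record DistinctCombination (P : Lin d → Set) (h : Lin d) : Set where
    field
      size     : ℕ
      terms    : Fin size → Lin d
      coeff    : Fin size → ℤ
      distinct : Injective _≡_ _≡_ terms
      terms∈P  : ∀ i → P (terms i)
      h≡       : h ≡ linComb size coeff terms

  linComb-distinct : ∀ {P : Lin d → Set} n c k → (∀ i → P (k i)) →
    DistinctCombination P (linComb n c k)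
  linComb-distinct zero c k _ = record
    { size = 0 ; terms = λ () ; coeff = λ () ; distinct = λ { {()} } ; terms∈P = λ () ; h≡ = refl }
  linComb-distinct {P} (suc n) c k k∈P
    with linComb-distinct {P} n (Vector.tail c) (Vector.tail k) (k∈P ∘ suc)
  ... | D with Fin.any? (λ i → DistinctCombination.terms D i ≟L k zero)
  ...   | yes (i , tᵢ≡k₀) = record
    { size     = size
    ; terms    = terms
    ; coeff    = updateAt coeff i (ℤ._+_ (c zero))
    ; distinct = distinct
    ; terms∈P  = terms∈P
    ; h≡       = begin
        (c zero ·L k zero) +L linComb n (Vector.tail c) (Vector.tail k)
          ≡⟨ cong ((c zero ·L k zero) +L_) h≡ ⟩
        (c zero ·L k zero) +L linComb size coeff terms
          ≡⟨ cong (λ t → (c zero ·L t) +L linComb size coeff terms) tᵢ≡k₀ ⟨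
        (c zero ·L terms i) +L linComb size coeff terms
          ≡⟨ linComb-updateAt size coeff terms i (c zero) ⟨
        linComb size (updateAt coeff i (ℤ._+_ (c zero))) terms ∎
    }
    where
    open DistinctCombination D
    open ≡-Reasoning
  ...   | no k₀∉terms = record
    { size     = suc size
    ; terms    = k zero Vector.∷ terms
    ; coeff    = c zero Vector.∷ coeff
    ; distinct = injective-∷ (λ i tᵢ≡k₀ → k₀∉terms (i , tᵢ≡k₀)) distinct
    ; terms∈P  = λ { zero → k∈P zero ; (suc i) → terms∈P i }
    ; h≡       = cong ((c zero ·L k zero) +L_) h≡
    }
    where open DistinctCombination D

  -- LinIndep only constrains injectively indexed families, whereas Span allows repetitions.
  span⇒distinctCombination : ∀ {P : Lin d → Set} {h} → Span P h → DistinctCombination P h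
  span⇒distinctCombination (n , k , c , k∈P , refl) = linComb-distinct n c k k∈P

  linIndep-coefficient≡0 : ∀ {S T : Lin d → Set} {u v h} x y → LinIndep S → (∀ w → T w → S w) →
    S u → S v → u ≢ v → (D : DistinctCombination T h) →
    (∀ i → DistinctCombination.terms D i ≢ u) → (∀ i → DistinctCombination.terms D i ≢ v) →
    ((x ·L u) +L ((y ·L v) +L h)) ≡ 0L → x ≡ 0ℤ
  linIndep-coefficient≡0 {S = S} {u = u} {v = v} x y independent T⊆S Su Sv u≢v D terms≢u terms≢v relation =
    independent (suc (suc size)) family family-distinct family∈S (x Vector.∷ y Vector.∷ coeff)
      (subst (λ t → ((x ·L u) +L ((y ·L v) +L t)) ≡ 0L) h≡ relation) zero
    where
    open DistinctCombination D
    family : Fin (suc (suc size)) → Lin d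
    family = u Vector.∷ v Vector.∷ terms
    family-distinct : Injective _≡_ _≡_ family
    family-distinct = injective-∷ (λ { zero → u≢v ∘ sym ; (suc i) → terms≢u i })
                                  (injective-∷ terms≢v distinct)
    family∈S : ∀ i → S (family i)
    family∈S zero          = Su
    family∈S (suc zero)    = Sv
    family∈S (suc (suc i)) = T⊆S (terms i) (terms∈P i)

lvVec-∷-≤ : ∀ {n} c (cs : Vec ℤ n) → lvVec (c ∷ cs) ≤ suc (lvVec cs)
lvVec-∷-≤ c cs with lvVec cs
... | suc _ = ℕ.≤-refl
... | zero with c ℤ.≟ 0ℤ
...   | yes _ = z≤n
...   | no  _ = s≤s z≤n

lvVec-tail-≤ : ∀ {n} c (cs : Vec ℤ n) → lvVec cs ≤ pred (lvVec (c ∷ cs))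
lvVec-tail-≤ c cs with lvVec cs
... | suc _ = ℕ.≤-refl
... | zero  = z≤n

lvVec-∷≡0⇒head≡0 : ∀ {n} c (cs : Vec ℤ n) → lvVec (c ∷ cs) ≡ 0 → c ≡ 0ℤ
lvVec-∷≡0⇒head≡0 c cs with lvVec cs
... | suc _ = λ ()
... | zero with c ℤ.≟ 0ℤ
...   | yes c≡0 = λ _ → c≡0
...   | no  _   = λ ()

lvVec-≤ : ∀ {n} (cs : Vec ℤ n) k → (∀ i → k ≤ toℕ i → lookup cs i ≡ 0ℤ) → lvVec cs ≤ k
lvVec-≤ []       k       _      = z≤n
lvVec-≤ (c ∷ cs) zero    vanish
  with lvVec cs | lvVec-≤ cs zero (λ i _ → vanish (suc i) z≤n) | vanish zero z≤n
... | zero | _ | refl = z≤n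
lvVec-≤ (c ∷ cs) (suc k) vanish =
  ℕ.≤-trans (lvVec-∷-≤ c cs) (s≤s (lvVec-≤ cs k (λ i → vanish (suc i) ∘ s≤s)))

lvVec-≤⇒vanishes : ∀ {n} (cs : Vec ℤ n) k → lvVec cs ≤ k → ∀ i → k ≤ toℕ i → lookup cs i ≡ 0ℤ
lvVec-≤⇒vanishes (c ∷ cs) k le zero    z≤n = lvVec-∷≡0⇒head≡0 c cs (ℕ.n≤0⇒n≡0 le)
lvVec-≤⇒vanishes (c ∷ cs) k le (suc i) k≤i =
  lvVec-≤⇒vanishes cs (pred k) (ℕ.≤-trans (lvVec-tail-≤ c cs) (ℕ.pred-mono-≤ le)) i (ℕ.pred-mono-≤ k≤i)

lvVec-≤-pred : ∀ {n j} (j<n : j < n) (cs : Vec ℤ n) →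
  lvVec cs ≤ suc j → lookup cs (fromℕ< j<n) ≡ 0ℤ → lvVec cs ≤ j
lvVec-≤-pred {j = j} j<n cs le cⱼ≡0 = lvVec-≤ cs j vanish
  where
  vanish : ∀ i → j ≤ toℕ i → lookup cs i ≡ 0ℤ
  vanish i j≤i with toℕ i ℕ.≟ j
  ... | yes i≡j = subst (λ i → lookup cs i ≡ 0ℤ)
                        (Fin.toℕ-injective (trans (Fin.toℕ-fromℕ< j<n) (sym i≡j))) cⱼ≡0
  ... | no  i≢j = lvVec-≤⇒vanishes cs (suc j) le i (ℕ.≤∧≢⇒< j≤i (i≢j ∘ sym))

module _ {d : ℕ} where

  lv-leading≢0 : ∀ {j} (j<d : j < d) (u : Lin d) → lv u ≡ suc j → lookup (coeffs u) (fromℕ< j<d) ≢ 0ℤ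
  lv-leading≢0 {j} j<d u lvu≡ uⱼ≡0 =
    ℕ.1+n≰n (subst (_≤ j) lvu≡ (lvVec-≤-pred j<d (coeffs u) (ℕ.≤-reflexive lvu≡) uⱼ≡0))

  lv-combination-≤ : ∀ k x y (u v : Lin d) → lv u ≤ k → lv v ≤ k → lv ((x ·L u) +L (y ·L v)) ≤ k
  lv-combination-≤ k x y u v lvu≤ lvv≤ = lvVec-≤ (coeffs ((x ·L u) +L (y ·L v))) k vanish
    where
    vanish : ∀ i → k ≤ toℕ i → lookup (coeffs ((x ·L u) +L (y ·L v))) i ≡ 0ℤ
    vanish i k≤i = begin
      lookup (coeffs ((x ·L u) +L (y ·L v))) i
        ≡⟨ lookup-coeffs-combination x y u v i ⟩
      x ℤ.* lookup (coeffs u) i ℤ.+ y ℤ.* lookup (coeffs v) i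
        ≡⟨ cong₂ (λ s t → x ℤ.* s ℤ.+ y ℤ.* t) (lvVec-≤⇒vanishes (coeffs u) k lvu≤ i k≤i)
                                             (lvVec-≤⇒vanishes (coeffs v) k lvv≤ i k≤i) ⟩
      x ℤ.* 0ℤ ℤ.+ y ℤ.* 0ℤ
        ≡⟨ cong₂ ℤ._+_ (ℤ.*-zeroʳ x) (ℤ.*-zeroʳ y) ⟩
      0ℤ ∎
      where open ≡-Reasoning

  lv-eliminate : ∀ {j} (j<d : j < d) (u v : Lin d) → lv u ≤ suc j → lv v ≤ suc j →
    lv ((lookup (coeffs v) (fromℕ< j<d) ·L u) +L ((- lookup (coeffs u) (fromℕ< j<d)) ·L v)) ≤ j
  lv-eliminate j<d u v lvu≤ lvv≤ =
    lvVec-≤-pred j<d (coeffs ((vⱼ ·L u) +L ((- uⱼ) ·L v))) (lv-combination-≤ (suc _) vⱼ (- uⱼ) u v lvu≤ lvv≤)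
      (trans (lookup-coeffs-combination vⱼ (- uⱼ) u v (fromℕ< j<d)) (cross-cancel vⱼ uⱼ))
    where
    uⱼ vⱼ : ℤ
    uⱼ = lookup (coeffs u) (fromℕ< j<d)
    vⱼ = lookup (coeffs v) (fromℕ< j<d)
    cross-cancel : ∀ a b → a ℤ.* b ℤ.+ (- b) ℤ.* a ≡ 0ℤ
    cross-cancel = solve-∀

primitive⇒primitivePartOf-self : ∀ {d} {f : Lin d} → Primitive f → PrimitivePartOf f f
primitive⇒primitivePartOf-self {f = f} f-primitive@(f≢0 , content≡1) =
  f≢0 , f-primitive , sym (trans (cong (_·L f) content≡1) (·L-identityˡ f))

lemma36 : ∀ (d : ℕ) (Φ : System d) → WellFormed Φ → ElimProperty Φ →
    ∀ (f : Lin d) → Primitive f → ∀ (j : ℕ) → 1 ≤ j → j ≤ d →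
    ∀ (g g′ : Lin d) → (f , g) ∈ Φ → (f , g′) ∈ Φ →
    lv g ≡ j → lv g′ ≡ j → g ≡ g′
lemma36 d Φ _ elim f f-primitive (suc j) _ j<d g g′ fg fg′ lvg lvg′ with g ≟L g′
... | yes g≡g′ = g≡g′
... | no  g≢g′ = contradiction a′≡0 (lv-leading≢0 j<d g′ lvg′)
  where
  basisAt : ∀ k → k ≤ d → IsBasisOf (λ u → lv u ≤ k × (f , u) ∈ Φ) (λ u → DivModule Φ f u × lv u ≤ k)
  basisAt = elim f (f , g , fg , primitive⇒primitivePartOf-self f-primitive)

  a a′ : ℤ
  a  = lookup (coeffs g)  (fromℕ< j<d)
  a′ = lookup (coeffs g′) (fromℕ< j<d)

  h : Lin d
  h = (a ·L g′) +L ((- a′) ·L g)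

  h∈M : DivModule Φ f h
  h∈M = add (scale a (proj₁ (proj₁ (proj₂ (basisAt (suc j) j<d)) g′ (ℕ.≤-reflexive lvg′ , fg′))))
            (scale (- a′) (proj₁ (proj₁ (proj₂ (basisAt (suc j) j<d)) g (ℕ.≤-reflexive lvg , fg))))

  lowerTerms : DistinctCombination (λ u → lv u ≤ j × (f , u) ∈ Φ) h
  lowerTerms = span⇒distinctCombination (Equivalence.to (proj₂ (proj₂ (basisAt j (ℕ.<⇒≤ j<d))) h)
    (h∈M , lv-eliminate j<d g′ g (ℕ.≤-reflexive lvg′) (ℕ.≤-reflexive lvg)))

  lowerTerm≢ : ∀ i {u} → lv u ≡ suc j → DistinctCombination.terms lowerTerms i ≢ u
  lowerTerm≢ i lvu refl = ℕ.1+n≰n (subst (_≤ j) lvu (proj₁ (DistinctCombination.terms∈P lowerTerms i)))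

  a′≡0 : a′ ≡ 0ℤ
  a′≡0 = linIndep-coefficient≡0 a′ (- a) (proj₁ (basisAt (suc j) j<d))
    (λ _ (lv≤j , fu) → ℕ.m≤n⇒m≤1+n lv≤j , fu) (ℕ.≤-reflexive lvg , fg) (ℕ.≤-reflexive lvg′ , fg′)
    g≢g′ lowerTerms (λ i → lowerTerm≢ i lvg) (λ i → lowerTerm≢ i lvg′) (·L-cancelPairs a′ a g g′)
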